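{- Let $R$ be a finite commutative local ring with unity and $x$ a nonzero element of $R$. Let $R^*$ be the units of $R$, $xR^* = \{xr: r\in R^*\}$, $I_x$ the ideal generated by $x$, and $M_x = I_x\setminus xR^*$. Then: (i) $\mathrm{Cay}(I_x, xR^*)$ is a complete $\frac{|I_x|}{|M_x|}$-partite graph whose partite sets are the cosets of $M_x$ in $I_x$; (ii) for each $z\in R$, $\mathrm{Cay}(I_x, xR^*)$ is isomorphic to the graph $G_{[z]}$ with vertex set $z + I_x$ and edge set $\{(z+a, z+b) : a - b \in xR^*\}$; (iii) for $a, b\in R$, there is a path between $a$ and $b$ in $\mathrm{Cay}(R, xR^*)$ if and only if $a$ and $b$ lie in the same coset of $I_x$ in $R$; (iv) $\mathrm{Cay}(R, xR^*)$ has exactly $\frac{|R|}{|I_x|}$ connected components; (v) $\mathrm{Cay}(I_x, xR^*)$ is isomorphic to each connected component of $\mathrm{Cay}(R, xR^*)$.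
   Context: For a subset $T\subseteq R$ closed under addition (here $T = R$ or $T = I_x$), $\mathrm{Cay}(T, xR^*)$ is the graph with vertex set $T$ in which $u,v$ are adjacent iff $u - v\in xR^*$. -}

module Defs where

open import Level using (Level; _⊔_)
open import Algebra.Bundles using (CommutativeRing)
open import Data.Nat using (ℕ)
open import Data.Fin using (Fin)
open import Data.Product using (Σ; ∃; _×_; _,_; proj₁; proj₂)
open import Data.Unit.Polymorphic using (⊤)
open import Relation.Nullary using (¬_)
open import Relation.Binary.Bundles using (Setoid)
open import Relation.Binary.Structures using (IsEquivalence)
open import Relation.Binary.PropositionalEquality using (_≡_)
import Relation.Binary.PropositionalEquality as ≡
open import Relation.Binary.Construct.Closure.ReflexiveTransitive using (Star)
open import Function.Bundles using (Inverse; _⇔_)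

module _ {c ℓ : Level} (R : CommutativeRing c ℓ) where
  open CommutativeRing R

  Pred : Set (Level.suc (c ⊔ ℓ))
  Pred = Carrier → Set (c ⊔ ℓ)

  SubSetoid : Pred → Setoid (c ⊔ ℓ) ℓ
  SubSetoid S = record
    { Carrier = Σ Carrier S
    ; _≈_ = λ u v → proj₁ u ≈ proj₁ v
    ; isEquivalence = record
      { refl = refl ; sym = sym ; trans = trans } }

  HasSize : Pred → ℕ → Set (c ⊔ ℓ)
  HasSize S n = Inverse (SubSetoid S) (≡.setoid (Fin n))

  Whole : Pred
  Whole _ = ⊤

  IsUnit : Carrier → Set (c ⊔ ℓ)
  IsUnit r = ∃ λ s → r * s ≈ 1#

  -- R is local: 1 ≠ 0 and the non-units are closed under addition
  -- (i.e. the non-units form an ideal, the unique maximal ideal).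
  IsLocal : Set (c ⊔ ℓ)
  IsLocal = (¬ (1# ≈ 0#)) × (∀ a b → ¬ IsUnit a → ¬ IsUnit b → ¬ IsUnit (a + b))

  xR* : Carrier → Pred
  xR* x y = ∃ λ r → IsUnit r × (y ≈ x * r)

  I : Carrier → Pred
  I x y = ∃ λ r → y ≈ x * r

  M : Carrier → Pred
  M x y = I x y × ¬ xR* x y

  record Graph : Set (Level.suc (c ⊔ ℓ)) where
    field
      V : Pred
      E : Carrier → Carrier → Set (c ⊔ ℓ)

  Cay : Pred → Carrier → Graph
  Cay T x = record { V = T ; E = λ u v → xR* x (u - v) }

  Gz : Carrier → Carrier → Graph
  Gz x z = record
    { V = λ w → ∃ λ a → I x a × (w ≈ z + a)
    ; E = λ u v → ∃ λ a → ∃ λ b → I x a × I x b × (u ≈ z + a) × (v ≈ z + b) × xR* x (a - b) }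

  record GraphIso (G H : Graph) : Set (c ⊔ ℓ) where
    field
      bij : Inverse (SubSetoid (Graph.V G)) (SubSetoid (Graph.V H))
    open Inverse bij
    field
      edges : ∀ u v → Graph.E G (proj₁ u) (proj₁ v) ⇔ Graph.E H (proj₁ (to u)) (proj₁ (to v))

  Path : Graph → Carrier → Carrier → Set (c ⊔ ℓ)
  Path G = Star (Graph.E G)

  Component : Carrier → Carrier → Graph
  Component x a = record { V = λ b → Path (Cay Whole x) a b ; E = Graph.E (Cay Whole x) }

  SameCoset : Carrier → Carrier → Carrier → Set (c ⊔ ℓ)
  SameCoset x a b = ∃ λ z → (∃ λ i → I x i × (a ≈ z + i)) × (∃ λ j → I x j × (b ≈ z + j))

  -- G is a complete k-partite graph whose partite sets are the classes of the
  -- relation Same: a surjective labelling p of the vertices by Fin k whose fibres are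
  -- exactly the Same-classes, and u ~ v iff p u ≠ p v.
  CompleteMultipartite : (G : Graph) → ℕ → (Carrier → Carrier → Set (c ⊔ ℓ)) → Set (c ⊔ ℓ)
  CompleteMultipartite G k Same =
    Σ (Σ Carrier (Graph.V G) → Fin k) λ p →
      (∀ j → ∃ λ u → p u ≡ j) ×
      (∀ u v → (p u ≡ p v) ⇔ Same (proj₁ u) (proj₁ v)) ×
      (∀ u v → Graph.E G (proj₁ u) (proj₁ v) ⇔ (¬ (p u ≡ p v)))

  -- G has exactly k connected components: a surjective labelling of the vertices by Fin k
  -- whose fibres are exactly the path-connectivity classes.
  HasComponents : Graph → ℕ → Set (c ⊔ ℓ)
  HasComponents G k =
    Σ (Σ Carrier (Graph.V G) → Fin k) λ p →
      (∀ j → ∃ λ u → p u ≡ j) ×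
      (∀ u v → (p u ≡ p v) ⇔ Path G (proj₁ u) (proj₁ v))

{-# OPTIONS --safe #-}
-- The counts in (i) and (iv) are Lagrange's theorem for the additive group: if H ⊆ G are finite additive
-- subgroups of R and membership in H is decidable, then G ≅ (G/H) × H. Locality makes
-- M_x = x·(non-units) an additive subgroup of I_x; here x ≠ 0 rules out x r = x s with r a non-unit
-- and s a unit, because x (s - r) = 0 forces s - r, hence s = (s - r) + r, to be a non-unit. So two
-- elements of I_x are adjacent exactly when they lie in different cosets of M_x. A difference x r
-- with r a non-unit is crossed in the two steps x and x (r - 1), as r - 1 is then a unit; hence the
-- components of Cay(R, xR*) are the cosets of I_x, and translation by z carries Cay(I_x, xR*) onto
-- each of them.
module Submission where

open import Defs
open import Level using (Level; _⊔_)
open import Algebra.Bundles using (CommutativeRing)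
open import Data.Nat using (ℕ; zero; suc)
import Data.Nat as ℕ
open import Data.Fin using (Fin; zero; suc)
import Data.Fin.Properties as Fin
open import Data.Fin.Permutation using (↔⇒≡)
open import Data.Product using (Σ; ∃; _×_; _,_; proj₁; proj₂)
open import Data.Unit.Polymorphic using (tt)
open import Function.Base using (_∘_; _on_)
open import Function.Bundles using (_⇔_; mk⇔; Equivalence; Inverse)
import Function.Construct.Composition as Compose
import Function.Construct.Symmetry as Symmetry
import Function.Consequences.Setoid as InverseConsequences
import Function.Properties.Equivalence as ⇔
open import Function.Properties.Inverse using (Inverse⇒Injection)
open import Relation.Nullary using (¬_; Dec; yes; no)
open import Relation.Nullary.Decidable using (_×-dec_; ¬?; map′)
open import Relation.Nullary.Negation using (contradiction)
open import Relation.Binary.Core using (Rel)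
open import Relation.Binary.Bundles using (Setoid)
open import Relation.Binary.Structures using (IsEquivalence; IsDecEquivalence)
import Relation.Binary.Construct.On as On
open import Relation.Binary.PropositionalEquality using (_≡_)
import Relation.Binary.PropositionalEquality as ≡
open import Relation.Binary.Construct.Closure.ReflexiveTransitive using (ε; _◅_)

FinQuotient : ∀ {a r} {A : Set a} → Rel A r → ℕ → Set (a ⊔ r)
FinQuotient {A = A} _~_ k =
  Σ (A → Fin k) λ p → (∀ j → ∃ λ u → p u ≡ j) × (∀ u v → (p u ≡ p v) ⇔ (u ~ v))

Fin-quotient : ∀ {r} N {_~_ : Rel (Fin N) r} → IsDecEquivalence _~_ → ∃ (FinQuotient _~_)
Fin-quotient zero _ = 0 , (λ ()) , (λ ()) , (λ ())
Fin-quotient (suc N) {_~_} isDecEq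
  with Fin-quotient N (On.isDecEquivalence suc isDecEq)
     | Fin.any? (λ b → IsDecEquivalence._≟_ isDecEq zero (suc b))
... | k , p , surj , ker | yes (b₀ , 0~b₀) = k , p⁺ , surj⁺ , ker⁺
  where
  open IsDecEquivalence isDecEq
  p⁺ : Fin (suc N) → Fin k
  p⁺ zero    = p b₀
  p⁺ (suc a) = p a
  surj⁺ : ∀ j → ∃ λ u → p⁺ u ≡ j
  surj⁺ j = suc (proj₁ (surj j)) , proj₂ (surj j)
  ker-0 : ∀ b → (p b₀ ≡ p b) ⇔ (zero ~ suc b)
  ker-0 b = mk⇔ (λ e → trans 0~b₀ (Equivalence.to (ker b₀ b) e))
                (λ 0~b → Equivalence.from (ker b₀ b) (trans (sym 0~b₀) 0~b))
  ker⁺ : ∀ u v → (p⁺ u ≡ p⁺ v) ⇔ (u ~ v)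
  ker⁺ zero    zero    = mk⇔ (λ _ → refl) (λ _ → ≡.refl)
  ker⁺ zero    (suc b) = ker-0 b
  ker⁺ (suc a) zero    = mk⇔ (sym ∘ Equivalence.to (ker-0 a) ∘ ≡.sym)
                             (≡.sym ∘ Equivalence.from (ker-0 a) ∘ sym)
  ker⁺ (suc a) (suc b) = ker a b
... | k , p , surj , ker | no 0≁suc = suc k , p⁺ , surj⁺ , ker⁺
  where
  open IsDecEquivalence isDecEq
  p⁺ : Fin (suc N) → Fin (suc k)
  p⁺ zero    = zero
  p⁺ (suc a) = suc (p a)
  surj⁺ : ∀ j → ∃ λ u → p⁺ u ≡ j
  surj⁺ zero    = zero , ≡.refl
  surj⁺ (suc j) = suc (proj₁ (surj j)) , ≡.cong suc (proj₂ (surj j))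
  ker⁺ : ∀ u v → (p⁺ u ≡ p⁺ v) ⇔ (u ~ v)
  ker⁺ zero    zero    = mk⇔ (λ _ → refl) (λ _ → ≡.refl)
  ker⁺ zero    (suc b) = mk⇔ (λ ()) (λ 0~b → contradiction (b , 0~b) 0≁suc)
  ker⁺ (suc a) zero    = mk⇔ (λ ()) (λ a~0 → contradiction (a , sym a~0) 0≁suc)
  ker⁺ (suc a) (suc b) = mk⇔ (Equivalence.to (ker a b) ∘ Fin.suc-injective)
                             (≡.cong suc ∘ Equivalence.from (ker a b))

module _ {a ℓ r : Level} (S : Setoid a ℓ) where
  open Setoid S

  finite-quotient : ∀ {N} → Inverse S (≡.setoid (Fin N)) →
                    {_~_ : Rel Carrier r} → IsDecEquivalence _~_ → (∀ {u v} → u ≈ v → u ~ v) →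
                    ∃ (FinQuotient _~_)
  finite-quotient {N} enum {_~_} isDecEq ≈⇒~
    with Fin-quotient N (On.isDecEquivalence (Inverse.from enum) isDecEq)
  ... | k , p , surj , ker = k , p ∘ to , surj′ , ker′
    where
    open Inverse enum
    open IsDecEquivalence isDecEq renaming (sym to ~-sym; trans to ~-trans)
    surj′ : ∀ j → ∃ λ u → p (to u) ≡ j
    surj′ j = from (proj₁ (surj j)) , ≡.trans (≡.cong p (strictlyInverseˡ _)) (proj₂ (surj j))
    from∘to~ : ∀ u → from (to u) ~ u
    from∘to~ u = ≈⇒~ (strictlyInverseʳ u)
    ~-from-to : ∀ u v → from (to u) ~ from (to v) ⇔ u ~ v
    ~-from-to u v = mk⇔ (λ e → ~-trans (~-sym (from∘to~ u)) (~-trans e (from∘to~ v)))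
                        (λ e → ~-trans (from∘to~ u) (~-trans e (~-sym (from∘to~ v))))
    ker′ : ∀ u v → (p (to u) ≡ p (to v)) ⇔ (u ~ v)
    ker′ u v = ⇔.trans (ker (to u) (to v)) (~-from-to u v)

module _ {c ℓ : Level} (R : CommutativeRing c ℓ) where
  open CommutativeRing R
  -- In +-abelianGroup, x // y unfolds to x - y, so the group lemmas on _//_ apply to _-_ directly.
  open import Algebra.Properties.AbelianGroup +-abelianGroup
    using (//-rightDividesˡ; //-rightDividesʳ; //-cong₂; ⁻¹-anti-homo‿-; ⁻¹-involutive; ⁻¹-∙-comm)
  open import Algebra.Properties.Ring ring using (-‿distribˡ-*; -‿distribʳ-*; x[y-z]≈xy-xz)
  open import Relation.Binary.Reasoning.Setoid setoid

  [x-y]+y≈x : ∀ x y → (x - y) + y ≈ x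
  [x-y]+y≈x x y = //-rightDividesˡ y x

  [x+y]-y≈x : ∀ x y → (x + y) - y ≈ x
  [x+y]-y≈x x y = //-rightDividesʳ y x

  x+[y-x]≈y : ∀ x y → x + (y - x) ≈ y
  x+[y-x]≈y x y = trans (+-comm x (y - x)) ([x-y]+y≈x y x)

  [x+y]-x≈y : ∀ x y → (x + y) - x ≈ y
  [x+y]-x≈y x y = trans (+-congʳ (+-comm x y)) ([x+y]-y≈x y x)

  x-[x-y]≈y : ∀ x y → x - (x - y) ≈ y
  x-[x-y]≈y x y = trans (+-congˡ (⁻¹-anti-homo‿- x y)) (x+[y-x]≈y x y)

  [x-y]+[y-z]≈x-z : ∀ x y z → (x - y) + (y - z) ≈ x - z
  [x-y]+[y-z]≈x-z x y z = begin
    (x - y) + (y - z)  ≈⟨ +-assoc (x - y) y (- z) ⟨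
    ((x - y) + y) - z  ≈⟨ +-congʳ ([x-y]+y≈x x y) ⟩
    x - z              ∎

  [x-y]-z≈[x-z]-y : ∀ x y z → (x - y) - z ≈ (x - z) - y
  [x-y]-z≈[x-z]-y x y z = begin
    (x - y) - z    ≈⟨ +-assoc x (- y) (- z) ⟩
    x + (- y - z)  ≈⟨ +-congˡ (+-comm (- y) (- z)) ⟩
    x + (- z - y)  ≈⟨ +-assoc x (- z) (- y) ⟨
    (x - z) - y    ∎

  [z+x]-[z+y]≈x-y : ∀ z x y → (z + x) - (z + y) ≈ x - y
  [z+x]-[z+y]≈x-y z x y = begin
    (z + x) - (z + y)        ≈⟨ +-congˡ (⁻¹-∙-comm z y) ⟨
    (z + x) + (- z - y)      ≈⟨ +-assoc (z + x) (- z) (- y) ⟨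
    ((z + x) - z) - y        ≈⟨ +-congʳ ([x+y]-x≈y z x) ⟩
    x - y                    ∎

  CosetRel : Pred R → Rel Carrier (c ⊔ ℓ)
  CosetRel H a b = H (a - b)

  record IsAdditiveSubgroup (H : Pred R) : Set (c ⊔ ℓ) where
    field
      resp-≈     : ∀ {a b} → a ≈ b → H a → H b
      0∈         : H 0#
      sub-closed : ∀ {a b} → H a → H b → H (a - b)

    neg-closed : ∀ {a} → H a → H (- a)
    neg-closed h = resp-≈ (+-identityˡ _) (sub-closed 0∈ h)

    +-closed : ∀ {a b} → H a → H b → H (a + b)
    +-closed ha hb = resp-≈ (+-congˡ (⁻¹-involutive _)) (sub-closed ha (neg-closed hb))

    ≈⇒coset : ∀ {a b} → a ≈ b → CosetRel H a b
    ≈⇒coset {a} {b} a≈b = resp-≈ (sym (trans (//-cong₂ a≈b refl) (-‿inverseʳ b))) 0∈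

    coset-isEquivalence : IsEquivalence (CosetRel H)
    coset-isEquivalence = record
      { refl  = ≈⇒coset refl
      ; sym   = λ {a} {b} h → resp-≈ (⁻¹-anti-homo‿- a b) (neg-closed h)
      ; trans = λ {a} {b} {d} h h′ → resp-≈ ([x-y]+[y-z]≈x-z a b d) (+-closed h h′)
      }

    coset-isDecEquivalence : (∀ a → Dec (H a)) → IsDecEquivalence (CosetRel H)
    coset-isDecEquivalence H? = record
      { isEquivalence = coset-isEquivalence
      ; _≟_           = λ a b → H? (a - b)
      }

  open IsAdditiveSubgroup

  module _ {G H : Pred R} (G-subgroup : IsAdditiveSubgroup G) (H-subgroup : IsAdditiveSubgroup H)
           (H⊆G : ∀ {a} → H a → G a) where

    coset-decomposition : ∀ {k m} → FinQuotient (CosetRel H on proj₁) k → HasSize R H m →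
                          Inverse (SubSetoid R G) (≡.setoid (Fin k × Fin m))
    coset-decomposition {k} {m} (p , surj , ker) H↔ = record
      { to        = to
      ; from      = from
      ; to-cong   = to-cong
      ; from-cong = from-cong
      ; inverse   = strictlyInverseˡ⇒inverseˡ {f = to} {f⁻¹ = from} to-cong to∘from
                  , strictlyInverseʳ⇒inverseʳ {f⁻¹ = from} {f = to} from-cong from∘to
      }
      where
      open InverseConsequences (SubSetoid R G) (≡.setoid (Fin k × Fin m))
      module H↔ = Inverse H↔
      rep : Fin k → Carrier
      rep j = proj₁ (proj₁ (surj j))
      rep∈G : ∀ j → G (rep j)
      rep∈G j = proj₂ (proj₁ (surj j))
      offset : Fin m → Carrier
      offset h = proj₁ (H↔.from h)
      offset-from-rep : ∀ u → H (proj₁ u - rep (p u))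
      offset-from-rep u = Equivalence.to (ker u (proj₁ (surj (p u)))) (≡.sym (proj₂ (surj (p u))))
      p-cong : ∀ {u v : Σ Carrier G} → proj₁ u ≈ proj₁ v → p u ≡ p v
      p-cong u≈v = Equivalence.from (ker _ _) (≈⇒coset H-subgroup u≈v)
      to : Σ Carrier G → Fin k × Fin m
      to u = p u , H↔.to (proj₁ u - rep (p u) , offset-from-rep u)
      from : Fin k × Fin m → Σ Carrier G
      from (j , h) = rep j + offset h , +-closed G-subgroup (rep∈G j) (H⊆G (proj₂ (H↔.from h)))
      from-cong : ∀ {jh jh′} → jh ≡ jh′ → proj₁ (from jh) ≈ proj₁ (from jh′)
      from-cong ≡.refl = refl
      to-cong : ∀ {u v : Σ Carrier G} → proj₁ u ≈ proj₁ v → to u ≡ to v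
      to-cong u≈v = ≡.cong₂ _,_ (p-cong u≈v)
                      (H↔.to-cong (//-cong₂ u≈v (reflexive (≡.cong rep (p-cong u≈v)))))
      to∘from : ∀ jh → to (from jh) ≡ jh
      to∘from (j , h) = ≡.cong₂ _,_ p[w]≡j (≡.trans (H↔.to-cong w-rep≈offset) (H↔.strictlyInverseˡ h))
        where
        w = rep j + offset h
        w-rep[j]≈offset : w - rep j ≈ offset h
        w-rep[j]≈offset = [x+y]-x≈y (rep j) (offset h)
        p[w]≡j : p (from (j , h)) ≡ j
        p[w]≡j = ≡.trans (Equivalence.from (ker _ _)
                            (resp-≈ H-subgroup (sym w-rep[j]≈offset) (proj₂ (H↔.from h))))
                         (proj₂ (surj j))
        w-rep≈offset : w - rep (p (from (j , h))) ≈ offset h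
        w-rep≈offset = trans (//-cong₂ refl (reflexive (≡.cong rep p[w]≡j))) w-rep[j]≈offset
      from∘to : ∀ u → proj₁ (from (to u)) ≈ proj₁ u
      from∘to u = trans (+-congˡ (H↔.strictlyInverseʳ _)) (x+[y-x]≈y (rep (p u)) (proj₁ u))

    lagrange : ∀ {i m} → HasSize R G i → HasSize R H m → (∀ a → Dec (H a)) →
               Σ ℕ λ k → k ℕ.* m ≡ i × FinQuotient (CosetRel H on proj₁) k
    lagrange {m = m} G↔ H↔ H?
      with finite-quotient (SubSetoid R G) G↔
             (On.isDecEquivalence proj₁ (coset-isDecEquivalence H-subgroup H?)) (≈⇒coset H-subgroup)
    ... | k , q = k , ≡.sym (↔⇒≡ i↔k*m) , q
      where
      i↔k*m = Compose.inverse (Symmetry.inverse G↔)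
                (Compose.inverse (coset-decomposition q H↔) (Symmetry.inverse (Fin.*↔× {k} {m})))

  Whole-isAdditiveSubgroup : IsAdditiveSubgroup (Whole R)
  Whole-isAdditiveSubgroup = record { resp-≈ = λ _ _ → tt ; 0∈ = tt ; sub-closed = λ _ _ → tt }

  I-isAdditiveSubgroup : ∀ x → IsAdditiveSubgroup (I R x)
  I-isAdditiveSubgroup x = record
    { resp-≈     = λ a≈b (r , a≈xr) → r , trans (sym a≈b) a≈xr
    ; 0∈         = 0# , sym (zeroʳ x)
    ; sub-closed = λ (r , a≈xr) (s , b≈xs) →
                     r - s , trans (//-cong₂ a≈xr b≈xs) (sym (x[y-z]≈xy-xz x r s))
    }

  xR*⊆I : ∀ {x y} → xR* R x y → I R x y
  xR*⊆I (r , _ , y≈xr) = r , y≈xr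

  xR*-resp-≈ : ∀ {x a b} → a ≈ b → xR* R x a → xR* R x b
  xR*-resp-≈ a≈b (r , r-unit , a≈xr) = r , r-unit , trans (sym a≈b) a≈xr

  IsUnit-resp-≈ : ∀ {r s} → r ≈ s → IsUnit R r → IsUnit R s
  IsUnit-resp-≈ r≈s (t , rt≈1) = t , trans (*-congʳ (sym r≈s)) rt≈1

  1#-unit : IsUnit R 1#
  1#-unit = 1# , *-identityˡ 1#

  -‿unit⇒unit : ∀ {r} → IsUnit R (- r) → IsUnit R r
  -‿unit⇒unit {r} (s , [-r]s≈1) = - s , (begin
    r * - s    ≈⟨ -‿distribʳ-* r s ⟨
    - (r * s)  ≈⟨ -‿distribˡ-* r s ⟩
    - r * s    ≈⟨ [-r]s≈1 ⟩
    1#         ∎)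

  annihilator-nonunit : ∀ {x u} → ¬ x ≈ 0# → x * u ≈ 0# → ¬ IsUnit R u
  annihilator-nonunit {x} {u} x≉0 xu≈0 (t , ut≈1) = x≉0 (begin
    x             ≈⟨ *-identityʳ x ⟨
    x * 1#        ≈⟨ *-congˡ ut≈1 ⟨
    x * (u * t)   ≈⟨ *-assoc x u t ⟨
    (x * u) * t   ≈⟨ *-congʳ xu≈0 ⟩
    0# * t        ≈⟨ zeroˡ t ⟩
    0#            ∎)

  sameCoset⇔coset : ∀ {x a b} → SameCoset R x a b ⇔ I R x (a - b)
  sameCoset⇔coset {x} {a} {b} = mk⇔
    (λ (z , (i , i∈I , a≈z+i) , (j , j∈I , b≈z+j)) →
       resp-≈ Iₓ (trans (sym ([z+x]-[z+y]≈x-y z i j)) (//-cong₂ (sym a≈z+i) (sym b≈z+j)))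
              (sub-closed Iₓ i∈I j∈I))
    (λ a-b∈I → b , (a - b , a-b∈I , sym (x+[y-x]≈y b a)) , (0# , 0∈ Iₓ , sym (+-identityʳ b)))
    where Iₓ = I-isAdditiveSubgroup x

  path⇒coset : ∀ {x a b} → Path R (Cay R (Whole R) x) a b → I R x (a - b)
  path⇒coset {x} ε          = IsEquivalence.refl (coset-isEquivalence (I-isAdditiveSubgroup x))
  path⇒coset {x} (e ◅ path) = IsEquivalence.trans (coset-isEquivalence (I-isAdditiveSubgroup x))
                                (xR*⊆I e) (path⇒coset path)

  translation-iso : ∀ {T x} (z : Carrier) (Γ : Graph R) →
                    (∀ {a} → T a → Graph.V Γ (z + a)) → (∀ {w} → Graph.V Γ w → T (w - z)) →
                    (∀ {a b} → T a → T b → xR* R x (a - b) ⇔ Graph.E Γ (z + a) (z + b)) →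
                    GraphIso R (Cay R T x) Γ
  translation-iso z Γ V-intro V-elim edges = record
    { bij   = record
      { to        = λ u → z + proj₁ u , V-intro (proj₂ u)
      ; from      = λ w → proj₁ w - z , V-elim (proj₂ w)
      ; to-cong   = +-congˡ
      ; from-cong = +-congʳ
      ; inverse   = (λ {w} y≈w-z → trans (+-congˡ y≈w-z) (x+[y-x]≈y z (proj₁ w)))
                  , (λ {u} y≈z+u → trans (+-congʳ y≈z+u) ([x+y]-x≈y z (proj₁ u)))
      }
    ; edges = λ u v → edges (proj₂ u) (proj₂ v)
    }

  Cay-I≅Gz : ∀ x z → GraphIso R (Cay R (I R x) x) (Gz R x z)
  Cay-I≅Gz x z = translation-iso z (Gz R x z) (λ {a} a∈I → a , a∈I , refl) V-elim edges
    where
    V-elim : ∀ {w} → Graph.V (Gz R x z) w → I R x (w - z)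
    V-elim (a , a∈I , w≈z+a) =
      resp-≈ (I-isAdditiveSubgroup x) (sym (trans (+-congʳ w≈z+a) ([x+y]-x≈y z a))) a∈I
    edges : ∀ {a b} → I R x a → I R x b → xR* R x (a - b) ⇔ Graph.E (Gz R x z) (z + a) (z + b)
    edges {a} {b} a∈I b∈I = mk⇔
      (λ e → a , b , a∈I , b∈I , refl , refl , e)
      (λ (a′ , b′ , _ , _ , z+a≈z+a′ , z+b≈z+b′ , e) → xR*-resp-≈ (begin
         a′ - b′            ≈⟨ [z+x]-[z+y]≈x-y z a′ b′ ⟨
         (z + a′) - (z + b′) ≈⟨ //-cong₂ z+a≈z+a′ z+b≈z+b′ ⟨
         (z + a) - (z + b)  ≈⟨ [z+x]-[z+y]≈x-y z a b ⟩
         a - b              ∎) e)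

  module _ (local : IsLocal R) where

    nonunit-sub-closed : ∀ {a b} → ¬ IsUnit R a → ¬ IsUnit R b → ¬ IsUnit R (a - b)
    nonunit-sub-closed {a} {b} a-nonunit b-nonunit =
      proj₂ local a (- b) a-nonunit (b-nonunit ∘ -‿unit⇒unit)

    module _ {x : Carrier} (x≉0 : ¬ x ≈ 0#) where

      x*nonunit⇒M : ∀ {y r} → ¬ IsUnit R r → y ≈ x * r → M R x y
      x*nonunit⇒M {y} {r} r-nonunit y≈xr = (r , y≈xr) , λ (s , s-unit , y≈xs) →
        let x[s-r]≈0 = begin
              x * (s - r)    ≈⟨ x[y-z]≈xy-xz x s r ⟩
              x * s - x * r  ≈⟨ //-cong₂ (trans (sym y≈xs) y≈xr) refl ⟩
              x * r - x * r  ≈⟨ -‿inverseʳ (x * r) ⟩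
              0#             ∎
        in proj₂ local (s - r) r (annihilator-nonunit x≉0 x[s-r]≈0) r-nonunit
             (IsUnit-resp-≈ (sym ([x-y]+y≈x s r)) s-unit)

      M-isAdditiveSubgroup : IsAdditiveSubgroup (M R x)
      M-isAdditiveSubgroup = record
        { resp-≈     = λ a≈b (a∈I , a∉xR*) → resp-≈ Iₓ a≈b a∈I , a∉xR* ∘ xR*-resp-≈ (sym a≈b)
        ; 0∈         = x*nonunit⇒M 0#-nonunit (sym (zeroʳ x))
        ; sub-closed = λ ((r , a≈xr) , a∉xR*) ((s , b≈xs) , b∉xR*) →
            x*nonunit⇒M (nonunit-sub-closed (λ r-unit → a∉xR* (r , r-unit , a≈xr))
                                            (λ s-unit → b∉xR* (s , s-unit , b≈xs)))
                        (trans (//-cong₂ a≈xr b≈xs) (sym (x[y-z]≈xy-xz x r s)))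
        }
        where
        Iₓ = I-isAdditiveSubgroup x
        0#-nonunit : ¬ IsUnit R 0#
        0#-nonunit (s , 0s≈1) = proj₁ local (trans (sym 0s≈1) (zeroˡ s))

  module _ {n : ℕ} (finite : HasSize R (Whole R) n) where
    open Inverse finite

    ≈-dec : ∀ a b → Dec (a ≈ b)
    ≈-dec a b = Fin.inj⇒≟ (Inverse⇒Injection finite) (a , tt) (b , tt)

    ∃-dec : ∀ {p} {P : Carrier → Set p} → (∀ {a b} → a ≈ b → P a → P b) → (∀ a → Dec (P a)) → Dec (∃ P)
    ∃-dec P-resp P? = map′ (λ (j , Pj) → proj₁ (from j) , Pj)
                           (λ (a , Pa) → to (a , tt) , P-resp (sym (strictlyInverseʳ (a , tt))) Pa)
                           (Fin.any? (P? ∘ proj₁ ∘ from))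

    IsUnit? : ∀ r → Dec (IsUnit R r)
    IsUnit? r = ∃-dec (λ s≈t rs≈1 → trans (*-congˡ (sym s≈t)) rs≈1) (λ s → ≈-dec (r * s) 1#)

    I? : ∀ x y → Dec (I R x y)
    I? x y = ∃-dec (λ r≈s y≈xr → trans y≈xr (*-congˡ r≈s)) (λ r → ≈-dec y (x * r))

    xR*? : ∀ x y → Dec (xR* R x y)
    xR*? x y = ∃-dec (λ r≈s (r-unit , y≈xr) → IsUnit-resp-≈ r≈s r-unit , trans y≈xr (*-congˡ r≈s))
                     (λ r → IsUnit? r ×-dec ≈-dec y (x * r))

    M? : ∀ x y → Dec (M R x y)
    M? x y = I? x y ×-dec ¬? (xR*? x y)

    I∖M⊆xR* : ∀ {x d} → I R x d → ¬ M R x d → xR* R x d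
    I∖M⊆xR* {x} {d} d∈I d∉M with xR*? x d
    ... | yes d∈xR* = d∈xR*
    ... | no  d∉xR* = contradiction (d∈I , d∉xR*) d∉M

    module _ (local : IsLocal R) where

      nonunit⇒r-1-unit : ∀ {r} → ¬ IsUnit R r → IsUnit R (r - 1#)
      nonunit⇒r-1-unit {r} r-nonunit with IsUnit? (r - 1#)
      ... | yes r-1-unit    = r-1-unit
      ... | no  r-1-nonunit = contradiction (IsUnit-resp-≈ (sym (x-[x-y]≈y r 1#)) 1#-unit)
                                            (nonunit-sub-closed local r-nonunit r-1-nonunit)

      coset⇒path : ∀ {x a b} → I R x (a - b) → Path R (Cay R (Whole R) x) a b
      coset⇒path {x} {a} {b} (r , a-b≈xr) with IsUnit? r
      ... | yes r-unit    = (r , r-unit , a-b≈xr) ◅ ε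
      ... | no  r-nonunit = step-x ◅ step-rest ◅ ε
        where
        step-x : xR* R x (a - (a - x))
        step-x = 1# , 1#-unit , trans (x-[x-y]≈y a x) (sym (*-identityʳ x))
        step-rest : xR* R x ((a - x) - b)
        step-rest = r - 1# , nonunit⇒r-1-unit r-nonunit , (begin
          (a - x) - b       ≈⟨ [x-y]-z≈[x-z]-y a x b ⟩
          (a - b) - x       ≈⟨ //-cong₂ (sym a-b≈xr) (*-identityʳ x) ⟨
          x * r - x * 1#    ≈⟨ x[y-z]≈xy-xz x r 1# ⟨
          x * (r - 1#)      ∎)

      path⇔coset : ∀ {x a b} → Path R (Cay R (Whole R) x) a b ⇔ I R x (a - b)
      path⇔coset = mk⇔ path⇒coset coset⇒path

      path⇔sameCoset : ∀ {x a b} → Path R (Cay R (Whole R) x) a b ⇔ SameCoset R x a b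
      path⇔sameCoset = ⇔.trans path⇔coset (⇔.sym sameCoset⇔coset)

      Cay-I≅Component : ∀ x a → GraphIso R (Cay R (I R x) x) (Component R x a)
      Cay-I≅Component x a = translation-iso a (Component R x a) V-intro V-elim edges
        where
        open IsEquivalence (coset-isEquivalence (I-isAdditiveSubgroup x)) renaming (sym to coset-sym)
        V-intro : ∀ {i} → I R x i → Path R (Cay R (Whole R) x) a (a + i)
        V-intro {i} i∈I =
          coset⇒path (coset-sym (resp-≈ (I-isAdditiveSubgroup x) (sym ([x+y]-x≈y a i)) i∈I))
        V-elim : ∀ {w} → Path R (Cay R (Whole R) x) a w → I R x (w - a)
        V-elim = coset-sym ∘ path⇒coset
        edges : ∀ {i j} → I R x i → I R x j → xR* R x (i - j) ⇔ xR* R x ((a + i) - (a + j))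
        edges {i} {j} _ _ = mk⇔ (xR*-resp-≈ (sym ([z+x]-[z+y]≈x-y a i j)))
                                (xR*-resp-≈ ([z+x]-[z+y]≈x-y a i j))

      Cay-I-isCompleteMultipartite :
        ∀ {x i m} → ¬ x ≈ 0# → HasSize R (I R x) i → HasSize R (M R x) m →
        Σ ℕ λ k → k ℕ.* m ≡ i × CompleteMultipartite R (Cay R (I R x) x) k (λ u v → M R x (u - v))
      Cay-I-isCompleteMultipartite {x} x≉0 I↔ M↔
        with lagrange (I-isAdditiveSubgroup x) (M-isAdditiveSubgroup local x≉0) proj₁ I↔ M↔ (M? x)
      ... | k , k*m≡i , p , surj , ker = k , k*m≡i , p , surj , ker , edges
        where
        edges : ∀ u v → xR* R x (proj₁ u - proj₁ v) ⇔ (¬ p u ≡ p v)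
        edges u v = mk⇔
          (λ u-v∈xR* pu≡pv → proj₂ (Equivalence.to (ker u v) pu≡pv) u-v∈xR*)
          (λ pu≢pv → I∖M⊆xR* (sub-closed (I-isAdditiveSubgroup x) (proj₂ u) (proj₂ v))
                              (pu≢pv ∘ Equivalence.from (ker u v)))

      Cay-hasComponents : ∀ {x i} → HasSize R (I R x) i →
                          Σ ℕ λ k → k ℕ.* i ≡ n × HasComponents R (Cay R (Whole R) x) k
      Cay-hasComponents {x} I↔
        with lagrange Whole-isAdditiveSubgroup (I-isAdditiveSubgroup x) _ finite I↔ (I? x)
      ... | k , k*i≡n , p , surj , ker =
        k , k*i≡n , p , surj , λ u v → ⇔.trans (ker u v) (⇔.sym path⇔coset)

open import Data.Nat using (_*_)

lemma3p2 : {c ℓ : Level} (R : CommutativeRing c ℓ) (n : ℕ) → HasSize R (Whole R) n →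
           IsLocal R → (x : CommutativeRing.Carrier R) → ¬ (CommutativeRing._≈_ R x (CommutativeRing.0# R)) →
           ((i m : ℕ) → HasSize R (I R x) i → HasSize R (M R x) m →
              Σ ℕ (λ k → (k * m ≡ i) × CompleteMultipartite R (Cay R (I R x) x) k (λ u v → M R x (CommutativeRing._-_ R u v))))
           × (∀ z → GraphIso R (Cay R (I R x) x) (Gz R x z))
           × (∀ a b → Path R (Cay R (Whole R) x) a b ⇔ SameCoset R x a b)
           × ((i : ℕ) → HasSize R (I R x) i →
              Σ ℕ (λ k → (k * i ≡ n) × HasComponents R (Cay R (Whole R) x) k))
           × (∀ a → GraphIso R (Cay R (I R x) x) (Component R x a))
lemma3p2 R n finite local x x≉0 =
    (λ _ _ → Cay-I-isCompleteMultipartite R finite local x≉0)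
  , Cay-I≅Gz R x
  , (λ _ _ → path⇔sameCoset R finite local)
  , (λ _ → Cay-hasComponents R finite local)
  , Cay-I≅Component R finite local x
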